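{- Let $k\geqslant 2$ be an integer, let $\nu(k)$ be the $2$-adic valuation of $k$, and let $\lambda:=1+\frac{1}{2(k-1)}$. Let $m,n$ be positive integers and $x$ a positive integer such that $x\equiv 2^{2m-1}-1\pmod{2^{2m}}$ and $3^{k-1}x\equiv 2^{2n}-1\pmod{2^{2n+1}}$. Let $y$ be the least positive integer satisfying $k2^{ -\nu(k)}\,y\equiv x\pmod{2^{2m+2n+1}}$. Then for every sufficiently large integer $N$, for every integer $r=1,2,\dots,k-1$ and every integer $j=0,1,\dots,2^{\lfloor\lambda N\rfloor}$, we have \[ t\left((y2^{kN-\nu(k)}+j)^r\right)=t\left((y2^{kN-\nu(k)+1}+j)^r\right). \]
   Context: For an integer $n\geqslant 0$, let $s_2(n)$ be the number of ones in the binary expansion of $n$; the Thue--Morse sequence is $t(n)=1$ if $s_2(n)$ is odd and $t(n)=0$ if $s_2(n)$ is even. $\lfloor\alpha\rfloor$ denotes the integer part of a real number $\alpha$. -}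

module Defs where

open import Data.Nat using (ℕ; zero; suc; _+_; _*_; _∸_; _^_; _/_; _%_)
open import Data.Nat.Properties using (m^n≢0)
open import Data.Integer using (ℤ; +_; _-_)
import Data.Integer.Divisibility as ℤDiv

infix 4 _≡_[mod_]
_≡_[mod_] : ℕ → ℕ → ℕ → Set
a ≡ b [mod M ] = (+ M) ℤDiv.∣ ((+ a) - (+ b))

-- Number of ones in the binary expansion, with fuel (fuel n ≥ number of bits of n).
onesF : ℕ → ℕ → ℕ
onesF zero    n = 0
onesF (suc f) n = n % 2 + onesF f (n / 2)

-- s₂(n): the binary digit sum of n (fuel n suffices since n has at most n bits).
s₂ : ℕ → ℕ
s₂ n = onesF n n

t : ℕ → ℕ
t n = s₂ n % 2

-- k · 2^{-v}  (used with v = ν(k), so that the division is exact).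
oddPart : ℕ → ℕ → ℕ
oddPart k v = _/_ k (2 ^ v) {{m^n≢0 2 v}}

-- ⌊λN⌋ with λ = 1 + 1/(2(k-1)) = (2k-1)/(2(k-1)), i.e. ⌊N(2k-1) / (2(k-1))⌋.
-- (For k ≤ 1 the value is irrelevant; the statement assumes k ≥ 2.)
floorLam : ℕ → ℕ → ℕ
floorLam k N with 2 * (k ∸ 1)
... | zero  = 0
... | suc d = (N * (2 * k ∸ 1)) / suc d

-- For fixed r and B = 2^a, the polynomial (yX + j)^r has nonnegative coefficients bounded
-- by (y + j)^r.  Once 2^a exceeds that bound, evaluating at X = 2^a just concatenates the
-- coefficients' binary expansions, so s₂((y 2^a + j)^r) is the sum of the coefficients'
-- digit sums: a quantity independent of a.  The hypotheses j ≤ 2^⌊λN⌋ and r ≤ k - 1 make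
-- (y + j)^r ≤ 2^((y + ⌊λN⌋)(k - 1)), which lies below 2^(kN - ν(k)) for large N because
-- λ(k - 1) < k.
module Submission where

open import Defs
open import Data.Nat using (ℕ; suc; _+_; _*_; _∸_; _^_; _≤_)
open import Data.Nat.Divisibility using (_∣_)
open import Data.Product using (∃-syntax)
open import Relation.Nullary using (¬_)
open import Relation.Binary.PropositionalEquality using (_≡_)

open import Data.Nat using (zero; _<_; _/_; _%_; z≤n; s≤s)
open import Data.Nat.Properties
open import Data.Nat.DivMod
open import Data.Nat.Divisibility using (∣⇒≤; divides-refl)
open import Data.Product using (_,_)
open import Data.List using (List; []; _∷_; map)
open import Data.Nat.ListAction using (sum)
open import Data.List.Relation.Unary.All using (All; []; _∷_)
import Data.List.Relation.Unary.All as All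
open import Relation.Binary.PropositionalEquality using (refl; sym; trans; cong; cong₂; subst; module ≡-Reasoning)
open import Data.Nat.Tactic.RingSolver using (solve-∀)

onesF-0 : ∀ f → onesF f 0 ≡ 0
onesF-0 zero    = refl
onesF-0 (suc f) = onesF-0 f

[1+n]/2≤n : ∀ n → suc n / 2 ≤ n
[1+n]/2≤n n = ≤-pred (m/n<m (suc n) 2 (s≤s (s≤s z≤n)))

onesF-fuel-irrelevant : ∀ f g n → n ≤ f → n ≤ g → onesF f n ≡ onesF g n
onesF-fuel-irrelevant zero    g       _       z≤n _   = sym (onesF-0 g)
onesF-fuel-irrelevant (suc f) zero    _       _   z≤n = onesF-0 (suc f)
onesF-fuel-irrelevant (suc f) (suc g) zero    _   _   = trans (onesF-0 (suc f)) (sym (onesF-0 (suc g)))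
onesF-fuel-irrelevant (suc f) (suc g) (suc n) n<f n<g =
  cong (suc n % 2 +_) (onesF-fuel-irrelevant f g (suc n / 2)
    (≤-trans ([1+n]/2≤n n) (≤-pred n<f)) (≤-trans ([1+n]/2≤n n) (≤-pred n<g)))

s₂≡n%2+s₂[n/2] : ∀ n → s₂ n ≡ n % 2 + s₂ (n / 2)
s₂≡n%2+s₂[n/2] zero    = refl
s₂≡n%2+s₂[n/2] (suc n) =
  cong (suc n % 2 +_) (onesF-fuel-irrelevant n (suc n / 2) (suc n / 2) ([1+n]/2≤n n) ≤-refl)

s₂[b+q*2]≡b+s₂[q] : ∀ b q → b < 2 → s₂ (b + q * 2) ≡ b + s₂ q
s₂[b+q*2]≡b+s₂[q] b q b<2 = begin
  s₂ (b + q * 2)                          ≡⟨ s₂≡n%2+s₂[n/2] (b + q * 2) ⟩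
  (b + q * 2) % 2 + s₂ ((b + q * 2) / 2)  ≡⟨ cong₂ (λ u w → u + s₂ w) low high ⟩
  b + s₂ q                                ∎
  where
  open ≡-Reasoning
  low : (b + q * 2) % 2 ≡ b
  low = trans ([m+kn]%n≡m%n b q 2) (m<n⇒m%n≡m b<2)
  high : (b + q * 2) / 2 ≡ q
  high = begin
    (b + q * 2) / 2     ≡⟨ +-distrib-/-∣ʳ b (divides-refl q) ⟩
    b / 2 + q * 2 / 2   ≡⟨ cong₂ _+_ (m<n⇒m/n≡0 b<2) (m*n/n≡m q 2) ⟩
    q                   ∎

s₂[c+2^a*X]≡s₂[c]+s₂[X] : ∀ a c X → c < 2 ^ a → s₂ (c + 2 ^ a * X) ≡ s₂ c + s₂ X
s₂[c+2^a*X]≡s₂[c]+s₂[X] zero    zero    X _        = cong s₂ (+-identityʳ X)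
s₂[c+2^a*X]≡s₂[c]+s₂[X] zero    (suc c) X (s≤s ())
s₂[c+2^a*X]≡s₂[c]+s₂[X] (suc a) c       X c<2^1+a = begin
  s₂ (c + 2 ^ suc a * X)                   ≡⟨ cong (λ z → s₂ (z + 2 ^ suc a * X)) (m≡m%n+[m/n]*n c 2) ⟩
  s₂ (c % 2 + c / 2 * 2 + 2 ^ suc a * X)   ≡⟨ cong s₂ (regroup (c % 2) (c / 2) (2 ^ a) X) ⟩
  s₂ (c % 2 + (c / 2 + 2 ^ a * X) * 2)     ≡⟨ s₂[b+q*2]≡b+s₂[q] (c % 2) (c / 2 + 2 ^ a * X) (m%n<n c 2) ⟩
  c % 2 + s₂ (c / 2 + 2 ^ a * X)           ≡⟨ cong (c % 2 +_) (s₂[c+2^a*X]≡s₂[c]+s₂[X] a (c / 2) X c/2<2^a) ⟩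
  c % 2 + (s₂ (c / 2) + s₂ X)              ≡⟨ sym (+-assoc (c % 2) _ _) ⟩
  c % 2 + s₂ (c / 2) + s₂ X                ≡⟨ cong (_+ s₂ X) (sym (s₂≡n%2+s₂[n/2] c)) ⟩
  s₂ c + s₂ X                              ∎
  where
  open ≡-Reasoning
  regroup : ∀ b q A X → b + q * 2 + (2 * A) * X ≡ b + (q + A * X) * 2
  regroup = solve-∀
  c/2<2^a : c / 2 < 2 ^ a
  c/2<2^a = *-cancelʳ-< 2 (c / 2) (2 ^ a)
    (≤-<-trans (m/n*n≤m c 2) (subst (c <_) (*-comm 2 (2 ^ a)) c<2^1+a))

Poly : Set
Poly = List ℕ

-- Coefficients are listed from the constant term upwards.
eval : ℕ → Poly → ℕ
eval B []       = 0
eval B (c ∷ cs) = c + B * eval B cs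

_+ₚ_ : Poly → Poly → Poly
[]       +ₚ ds       = ds
(c ∷ cs) +ₚ []       = c ∷ cs
(c ∷ cs) +ₚ (d ∷ ds) = c + d ∷ (cs +ₚ ds)

scale : ℕ → Poly → Poly
scale a = map (a *_)

*linear : ℕ → ℕ → Poly → Poly
*linear y j cs = scale j cs +ₚ (0 ∷ scale y cs)

linearPow : ℕ → ℕ → ℕ → Poly
linearPow y j zero    = 1 ∷ []
linearPow y j (suc r) = *linear y j (linearPow y j r)

eval-+ₚ : ∀ B cs ds → eval B (cs +ₚ ds) ≡ eval B cs + eval B ds
eval-+ₚ B []       ds       = refl
eval-+ₚ B (c ∷ cs) []       = sym (+-identityʳ _)
eval-+ₚ B (c ∷ cs) (d ∷ ds) =
  trans (cong (λ z → c + d + B * z) (eval-+ₚ B cs ds)) (interchange c d B (eval B cs) (eval B ds))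
  where
  interchange : ∀ c d B e f → c + d + B * (e + f) ≡ (c + B * e) + (d + B * f)
  interchange = solve-∀

eval-scale : ∀ B a cs → eval B (scale a cs) ≡ a * eval B cs
eval-scale B a []       = sym (*-zeroʳ a)
eval-scale B a (c ∷ cs) =
  trans (cong (λ z → a * c + B * z) (eval-scale B a cs)) (factor a c B (eval B cs))
  where
  factor : ∀ a c B e → a * c + B * (a * e) ≡ a * (c + B * e)
  factor = solve-∀

eval-*linear : ∀ B y j cs → eval B (*linear y j cs) ≡ (y * B + j) * eval B cs
eval-*linear B y j cs = begin
  eval B (scale j cs +ₚ (0 ∷ scale y cs))               ≡⟨ eval-+ₚ B (scale j cs) (0 ∷ scale y cs) ⟩
  eval B (scale j cs) + (0 + B * eval B (scale y cs))   ≡⟨ cong₂ (λ u w → u + (0 + B * w)) (eval-scale B j cs) (eval-scale B y cs) ⟩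
  j * eval B cs + (0 + B * (y * eval B cs))             ≡⟨ factor j y B (eval B cs) ⟩
  (y * B + j) * eval B cs                               ∎
  where
  open ≡-Reasoning
  factor : ∀ j y B e → j * e + (0 + B * (y * e)) ≡ (y * B + j) * e
  factor = solve-∀

eval-linearPow : ∀ B y j r → eval B (linearPow y j r) ≡ (y * B + j) ^ r
eval-linearPow B y j zero    = cong (1 +_) (*-zeroʳ B)
eval-linearPow B y j (suc r) =
  trans (eval-*linear B y j (linearPow y j r)) (cong ((y * B + j) *_) (eval-linearPow B y j r))

coefficients≤eval-1 : ∀ cs → All (_≤ eval 1 cs) cs
coefficients≤eval-1 []       = []
coefficients≤eval-1 (c ∷ cs) =
  m≤m+n c _ ∷ All.map (λ c′≤ → ≤-trans c′≤ (≤-trans (≤-reflexive (sym (*-identityˡ _))) (m≤n+m _ c)))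
                      (coefficients≤eval-1 cs)

s₂[eval-2^a]≡sum-s₂ : ∀ a cs → All (_< 2 ^ a) cs → s₂ (eval (2 ^ a) cs) ≡ sum (map s₂ cs)
s₂[eval-2^a]≡sum-s₂ a []       []         = refl
s₂[eval-2^a]≡sum-s₂ a (c ∷ cs) (c< ∷ cs<) =
  trans (s₂[c+2^a*X]≡s₂[c]+s₂[X] a c (eval (2 ^ a) cs) c<) (cong (s₂ c +_) (s₂[eval-2^a]≡sum-s₂ a cs cs<))

s₂[[y*2^a+j]^r]≡sum-s₂ : ∀ a y j r → (y + j) ^ r < 2 ^ a →
                         s₂ ((y * 2 ^ a + j) ^ r) ≡ sum (map s₂ (linearPow y j r))
s₂[[y*2^a+j]^r]≡sum-s₂ a y j r small = begin
  s₂ ((y * 2 ^ a + j) ^ r)               ≡⟨ cong s₂ (sym (eval-linearPow (2 ^ a) y j r)) ⟩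
  s₂ (eval (2 ^ a) (linearPow y j r))    ≡⟨ s₂[eval-2^a]≡sum-s₂ a (linearPow y j r) (All.map coefficient< (coefficients≤eval-1 (linearPow y j r))) ⟩
  sum (map s₂ (linearPow y j r))         ∎
  where
  open ≡-Reasoning
  eval-1 : eval 1 (linearPow y j r) ≡ (y + j) ^ r
  eval-1 = trans (eval-linearPow 1 y j r) (cong (λ z → (z + j) ^ r) (*-identityʳ y))
  coefficient< : ∀ {c} → c ≤ eval 1 (linearPow y j r) → c < 2 ^ a
  coefficient< c≤ = ≤-<-trans (≤-trans c≤ (≤-reflexive eval-1)) small

s₂[[y*2^a+j]^r]≡s₂[[y*2^[1+a]+j]^r] : ∀ a y j r → (y + j) ^ r < 2 ^ a →
                                       s₂ ((y * 2 ^ a + j) ^ r) ≡ s₂ ((y * 2 ^ (a + 1) + j) ^ r)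
s₂[[y*2^a+j]^r]≡s₂[[y*2^[1+a]+j]^r] a y j r small =
  trans (s₂[[y*2^a+j]^r]≡sum-s₂ a y j r small)
        (sym (s₂[[y*2^a+j]^r]≡sum-s₂ (a + 1) y j r (<-≤-trans small (^-monoʳ-≤ 2 (m≤m+n a 1)))))

n<2^n : ∀ n → n < 2 ^ n
n<2^n zero    = s≤s z≤n
n<2^n (suc n) = ≤-trans (+-mono-≤ (m^n>0 2 n) (n<2^n n)) (≤-reflexive (cong (2 ^ n +_) (sym (+-identityʳ (2 ^ n)))))

[y+j]^r≤2^[[y+L]*K] : ∀ y j L r K → j ≤ 2 ^ L → r ≤ K → (y + j) ^ r ≤ 2 ^ ((y + L) * K)
[y+j]^r≤2^[[y+L]*K] y j L r K j≤2^L r≤K = begin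
  (y + j) ^ r           ≤⟨ ^-monoˡ-≤ r y+j≤2^[y+L] ⟩
  (2 ^ (y + L)) ^ r     ≤⟨ ^-monoʳ-≤ (2 ^ (y + L)) {{m^n≢0 2 (y + L)}} r≤K ⟩
  (2 ^ (y + L)) ^ K     ≡⟨ ^-*-assoc 2 (y + L) K ⟩
  2 ^ ((y + L) * K)     ∎
  where
  open ≤-Reasoning
  y+j≤2^[y+L] : y + j ≤ 2 ^ (y + L)
  y+j≤2^[y+L] = begin
    y + j               ≤⟨ +-mono-≤ (m≤m*n y (2 ^ L) {{m^n≢0 2 L}}) j≤2^L ⟩
    y * 2 ^ L + 2 ^ L   ≡⟨ +-comm (y * 2 ^ L) (2 ^ L) ⟩
    suc y * 2 ^ L       ≤⟨ *-monoˡ-≤ (2 ^ L) (n<2^n y) ⟩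
    2 ^ y * 2 ^ L       ≡⟨ sym (^-distribˡ-+-* 2 y L) ⟩
    2 ^ (y + L)         ∎

floorLam-bound : ∀ K N → floorLam (suc (suc K)) N * (2 * suc K) ≤ N * (2 * suc K + 1)
floorLam-bound K N =
  subst (λ e → N * e / (2 * suc K) * (2 * suc K) ≤ N * (2 * suc K + 1)) (sym (cong (_∸ 1) (2[2+K]≡1+[2[1+K]+1] K)))
        (m/n*n≤m (N * (2 * suc K + 1)) (2 * suc K))
  where
  2[2+K]≡1+[2[1+K]+1] : ∀ K → 2 * suc (suc K) ≡ suc (2 * suc K + 1)
  2[2+K]≡1+[2[1+K]+1] = solve-∀

[y+L]*K<[1+K]*N∸v : ∀ y L K v N → v ≤ K → 2 * (y * K + K + 1) ≤ N → L * (2 * K) ≤ N * (2 * K + 1) →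
                    (y + L) * K < suc K * N ∸ v
[y+L]*K<[1+K]*N∸v y L K v N v≤K N₀≤N L-bound = m+n≤o⇒m≤o∸n (suc ((y + L) * K)) (*-cancelˡ-≤ 2 (begin
  2 * (suc ((y + L) * K) + v)             ≡⟨ expand y L K v ⟩
  2 * (y * K + v + 1) + L * (2 * K)       ≤⟨ +-mono-≤ (≤-trans (*-monoʳ-≤ 2 (+-monoˡ-≤ 1 (+-monoʳ-≤ (y * K) v≤K))) N₀≤N) L-bound ⟩
  N + N * (2 * K + 1)                     ≡⟨ collect K N ⟩
  2 * (suc K * N)                         ∎))
  where
  open ≤-Reasoning
  expand : ∀ y L K v → 2 * (suc ((y + L) * K) + v) ≡ 2 * (y * K + v + 1) + L * (2 * K)
  expand = solve-∀
  collect : ∀ K N → N + N * (2 * K + 1) ≡ 2 * (suc K * N)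
  collect = solve-∀

lemma2p4 : ∀ (k : ℕ) → 2 ≤ k →
           ∀ (v : ℕ) → 2 ^ v ∣ k → ¬ (2 ^ suc v ∣ k) →
           ∀ (m n x : ℕ) → 1 ≤ m → 1 ≤ n → 1 ≤ x →
           x ≡ 2 ^ (2 * m ∸ 1) ∸ 1 [mod 2 ^ (2 * m) ] →
           3 ^ (k ∸ 1) * x ≡ 2 ^ (2 * n) ∸ 1 [mod 2 ^ (2 * n + 1) ] →
           ∀ (y : ℕ) → 1 ≤ y →
           oddPart k v * y ≡ x [mod 2 ^ (2 * m + 2 * n + 1) ] →
           (∀ (z : ℕ) → 1 ≤ z → oddPart k v * z ≡ x [mod 2 ^ (2 * m + 2 * n + 1) ] → y ≤ z) →
           ∃[ N₀ ] (∀ (N : ℕ) → N₀ ≤ N →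
             ∀ (r : ℕ) → 1 ≤ r → r ≤ k ∸ 1 →
             ∀ (j : ℕ) → j ≤ 2 ^ floorLam k N →
             t ((y * 2 ^ (k * N ∸ v) + j) ^ r) ≡ t ((y * 2 ^ (k * N ∸ v + 1) + j) ^ r))
lemma2p4 (suc (suc K)) _ v 2^v∣k _ _ _ _ _ _ _ _ _ y _ _ _ =
  2 * (y * suc K + suc K + 1) , λ N N₀≤N r _ r≤K j j≤2^L →
    cong (_% 2) (s₂[[y*2^a+j]^r]≡s₂[[y*2^[1+a]+j]^r] (suc (suc K) * N ∸ v) y j r
      (≤-<-trans ([y+j]^r≤2^[[y+L]*K] y j (floorLam (suc (suc K)) N) r (suc K) j≤2^L r≤K)
                 (^-monoʳ-< 2 (s≤s (s≤s z≤n))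
                   ([y+L]*K<[1+K]*N∸v y _ (suc K) v N v≤K N₀≤N (floorLam-bound K N)))))
  where
  v≤K : v ≤ suc K
  v≤K = ≤-pred (≤-trans (n<2^n v) (∣⇒≤ 2^v∣k))
lemma2p4 (suc zero) (s≤s ()) _ _ _ _ _ _ _ _ _ _ _ _ _ _ _
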